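{- For every integer $n\ge 3$, the congruence lattice of the bipartition lattice $\mathrm{Bip}(n)$ is isomorphic to the lattice obtained from a Boolean lattice with $n\cdot 2^{n-1}$ atoms by adding a new top element.
   Context: $[n]=\{1,\dots,n\}$. $\mathrm{Bip}(n)$ is the set of bipartitions of $[n]$, i.e. transitive relations $\mathbf{x}\subseteq[n]\times[n]$ whose complement in $[n]\times[n]$ is also transitive, ordered by inclusion; it is a lattice whose join is the transitive closure of the union and whose meet of $\mathbf{x},\mathbf{y}$ is the largest subset of $\mathbf{x}\cap\mathbf{y}$ with transitive complement. -}

module Defs where

open import Data.Nat using (ℕ; _*_; _^_; _∸_)
open import Data.Fin using (Fin)
open import Data.Fin.Subset using (Subset; _⊆_)
open import Data.Bool using (Bool; T; not)
open import Data.Product using (Σ; _×_)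
open import Function.Bundles using (_⇔_)
open import Relation.Binary.PropositionalEquality using (_≡_)

BRel : ℕ → Set
BRel n = Fin n → Fin n → Bool

Transitive : ∀ {n} → BRel n → Set
Transitive {n} r = ∀ (i j k : Fin n) → T (r i j) → T (r j k) → T (r i k)

Compl : ∀ {n} → BRel n → BRel n
Compl r i j = not (r i j)

IsBipartition : ∀ {n} → BRel n → Set
IsBipartition r = Transitive r × Transitive (Compl r)

Bip : ℕ → Set
Bip n = Σ (BRel n) IsBipartition

rel : ∀ {n} → Bip n → BRel n
rel = Data.Product.proj₁

_⊑_ : ∀ {n} → Bip n → Bip n → Set
_⊑_ {n} x y = ∀ (i j : Fin n) → T (rel x i j) → T (rel y i j)

IsJoin : ∀ {n} → Bip n → Bip n → Bip n → Set
IsJoin {n} x y z = x ⊑ z × y ⊑ z × (∀ (w : Bip n) → x ⊑ w → y ⊑ w → z ⊑ w)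

IsMeet : ∀ {n} → Bip n → Bip n → Bip n → Set
IsMeet {n} x y z = z ⊑ x × z ⊑ y × (∀ (w : Bip n) → w ⊑ x → w ⊑ y → w ⊑ z)

IsCongruence : ∀ {n} → (Bip n → Bip n → Bool) → Set
IsCongruence {n} θ =
  (∀ x → T (θ x x)) ×
  (∀ x y → T (θ x y) → T (θ y x)) ×
  (∀ x y z → T (θ x y) → T (θ y z) → T (θ x z)) ×
  (∀ (x x′ y y′ z z′ : Bip n) → T (θ x x′) → T (θ y y′) →
     IsJoin x y z → IsJoin x′ y′ z′ → T (θ z z′)) ×
  (∀ (x x′ y y′ z z′ : Bip n) → T (θ x x′) → T (θ y y′) →
     IsMeet x y z → IsMeet x′ y′ z′ → T (θ z z′))

Con : ℕ → Set
Con n = Σ (Bip n → Bip n → Bool) IsCongruence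

_≤ᶜ_ : ∀ {n} → Con n → Con n → Set
_≤ᶜ_ {n} θ ψ = ∀ (x y : Bip n) →
  T (Data.Product.proj₁ θ x y) → T (Data.Product.proj₁ ψ x y)

_≈ᶜ_ : ∀ {n} → Con n → Con n → Set
θ ≈ᶜ ψ = θ ≤ᶜ ψ × ψ ≤ᶜ θ

data WithTop (A : Set) : Set where
  ↑_ : A → WithTop A
  ⊤ᵗ : WithTop A

-- Boolean lattice with k atoms = Subset k ordered by ⊆, plus a new top
_≤ᵗ_ : ∀ {k} → WithTop (Subset k) → WithTop (Subset k) → Set
_≤ᵗ_ _ ⊤ᵗ = Data.Unit.⊤ where import Data.Unit
_≤ᵗ_ ⊤ᵗ (↑ _) = Data.Empty.⊥ where import Data.Empty
_≤ᵗ_ (↑ a) (↑ b) = a ⊆ b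

-- Lattice isomorphism (= order isomorphism) Con(Bip n) ≅ (2^k)+⊤
ConIsoBoolTop : ℕ → ℕ → Set
ConIsoBoolTop n k =
  Σ (Con n → WithTop (Subset k)) λ f →
  Σ (WithTop (Subset k) → Con n) λ g →
    (∀ θ → g (f θ) ≈ᶜ θ) ×
    (∀ t → f (g t) ≡ t) ×
    (∀ θ ψ → (θ ≤ᶜ ψ) ⇔ (f θ ≤ᵗ f ψ))

module Submission where

-- Bipartitions here may contain diagonal pairs (i , i),
-- and a congruence θ splits into an off-diagonal and a diagonal part.
--
-- * Off the diagonal Bip(n) is simple: if θ relates two bipartitions that
--   differ at a pair (p , q) with p ≢ q, then θ collapses bot and top, hence
--   everything (the argument needs a third point, i.e. n ≥ 3).
-- * On the diagonal θ is governed by the toggles E i X ⊏ E⁺ i X: the least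
--   bipartitions with row X at i, without resp. with the loop (i , i).  A
--   congruence not collapsing bot and top relates x and y iff they agree off
--   the diagonal and, wherever their diagonals differ at i, θ collapses the
--   toggle at (i , row of x at i).
-- * Conversely every predicate P on such pairs (i , row off i) defines a
--   congruence θ[ P ]; joins are handled directly, meets by complementation.
--
-- The non-total congruences are thus the subsets of the n · 2^(n-1) pairs
-- (i , row off i), coded by Fin (n · 2^(n-1)), and the total one is the top.

open import Defs
open import Data.Nat using (ℕ; zero; suc; _+_; _<_; _≤_; _<ᵇ_; _*_; _^_; _∸_; s≤s)
open import Data.Nat.Properties
  using (<ᵇ⇒<; <⇒<ᵇ; ≮⇒≥; <-trans; ≤-<-trans; <-irrefl; ≤∧≢⇒<; m<1+n⇒m≤n; m<n⇒m<1+n; n<1+n; <⇒≤; ≤-refl)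
open import Data.Fin using (Fin; zero; suc; _≟_; toℕ; fromℕ<; punchIn; punchOut; combine; remQuot; funToFin; finToFun)
open import Data.Fin.Properties
  using (all?; toℕ<n; toℕ-fromℕ<; toℕ-injective; punchInᵢ≢i; punchIn-punchOut; punchOut-punchIn; punchOut-cong;
         remQuot-combine; combine-remQuot; finToFun-funToFin; funToFin-finToFin; 2↔Bool)
open import Data.Fin.Subset using (Subset; _⊆_; _∈_)
open import Data.Bool using (Bool; true; false; T; not; _∧_; _∨_; if_then_else_)
open import Data.Bool.Properties using (T-∧; T-∨; T-≡; T-not-≡; not-involutive; not-injective) renaming (_≟_ to _≟ᵇ_)
open import Data.Product using (Σ; ∃; _×_; _,_; proj₁; proj₂)
open import Data.Sum using (_⊎_; inj₁; inj₂; [_,_])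
open import Data.Empty using (⊥; ⊥-elim)
open import Data.Unit using (tt)
open import Data.Vec using (lookup; tabulate)
open import Data.Vec.Properties using (lookup∘tabulate; tabulate∘lookup; tabulate-cong; []=⇒lookup; lookup⇒[]=)
open import Function using (_∘_)
open import Function.Bundles using (_⇔_; mk⇔; Equivalence; Inverse)
open import Relation.Nullary using (¬_; Dec; yes; no)
open import Relation.Nullary.Decidable using (⌊_⌋; toWitness; fromWitness; T?; ¬?; _×-dec_; _→-dec_)
open import Relation.Binary.PropositionalEquality
  using (_≡_; _≢_; refl; sym; trans; cong; cong₂; subst; _≗_; module ≡-Reasoning)

T-not : ∀ {b} → ¬ T b → T (not b)
T-not {false} _ = tt
T-not {true} ¬b = ¬b tt

not-T : ∀ {b} → T (not b) → ¬ T b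
not-T {false} _ ()

T-ext : ∀ {a b} → (T a → T b) → (T b → T a) → a ≡ b
T-ext {false} {false} _ _ = refl
T-ext {false} {true} _ g = ⊥-elim (g tt)
T-ext {true} {false} f _ = ⊥-elim (f tt)
T-ext {true} {true} _ _ = refl

false-of : ∀ {b} → ¬ T b → b ≡ false
false-of ¬b = Equivalence.to T-not-≡ (T-not ¬b)

differ : ∀ {a b} → a ≢ b → (T a × ¬ T b) ⊎ (¬ T a × T b)
differ {false} {false} ne = ⊥-elim (ne refl)
differ {false} {true} _ = inj₂ ((λ ()) , tt)
differ {true} {false} _ = inj₁ (tt , (λ ()))
differ {true} {true} ne = ⊥-elim (ne refl)

∧-intro : ∀ {a b} → T a → T b → T (a ∧ b)
∧-intro p q = Equivalence.from T-∧ (p , q)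

∧-fst : ∀ {a b} → T (a ∧ b) → T a
∧-fst h = proj₁ (Equivalence.to T-∧ h)

∧-snd : ∀ {a b} → T (a ∧ b) → T b
∧-snd h = proj₂ (Equivalence.to T-∧ h)

∨-inl : ∀ {a b} → T a → T (a ∨ b)
∨-inl p = Equivalence.from T-∨ (inj₁ p)

∨-inr : ∀ {a b} → T b → T (a ∨ b)
∨-inr q = Equivalence.from T-∨ (inj₂ q)

∨-cases : ∀ {a b} → T (a ∨ b) → T a ⊎ T b
∨-cases = Equivalence.to T-∨

_==_ : ∀ {n} → Fin n → Fin n → Bool
i == j = ⌊ i ≟ j ⌋

==-refl : ∀ {n} (i : Fin n) → T (i == i)
==-refl i = fromWitness refl

-- A case split on equality of points that leaves goals mentioning _==_
-- unchanged.
≡-or-≢ : ∀ {n} (i j : Fin n) → i ≡ j ⊎ i ≢ j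
≡-or-≢ i j with i ≟ j
... | yes e = inj₁ e
... | no ne = inj₂ ne

==-true : ∀ {n} {i j : Fin n} → i ≡ j → (i == j) ≡ true
==-true {i = i} {j} e with i ≟ j
... | yes _ = refl
... | no ne = ⊥-elim (ne e)

==-false : ∀ {n} {i j : Fin n} → i ≢ j → (i == j) ≡ false
==-false {i = i} {j} ne with i ≟ j
... | yes e = ⊥-elim (ne e)
... | no _ = refl

module _ {n : ℕ} where

  ⟦_⟧ : Bip n → Fin n → Fin n → Set
  ⟦ x ⟧ u v = T (rel x u v)

  bip-trans : (x : Bip n) → ∀ u v w → ⟦ x ⟧ u v → ⟦ x ⟧ v w → ⟦ x ⟧ u w
  bip-trans x = proj₁ (proj₂ x)

  -- Transitivity of the complement, read contrapositively: every pair of a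
  -- bipartition splits through every third point.
  bip-split : (x : Bip n) → ∀ u v w → ⟦ x ⟧ u w → ⟦ x ⟧ u v ⊎ ⟦ x ⟧ v w
  bip-split x u v w h with T? (rel x u v) | T? (rel x v w)
  ... | yes p | _ = inj₁ p
  ... | no _ | yes q = inj₂ q
  ... | no ¬p | no ¬q = ⊥-elim (not-T (proj₂ (proj₂ x) u v w (T-not ¬p) (T-not ¬q)) h)

  mkBip : (r : BRel n) → (∀ u v w → T (r u v) → T (r v w) → T (r u w)) →
          (∀ u v w → T (r u w) → T (r u v) ⊎ T (r v w)) → Bip n
  mkBip r tr sp = r , tr , λ u v w p q → T-not (λ h → [ not-T p , not-T q ] (sp u v w h))

  ⊑-refl : (x : Bip n) → x ⊑ x
  ⊑-refl x u v h = h

  join-≤ : (x y : Bip n) → x ⊑ y → IsJoin x y y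
  join-≤ x y x⊑y = x⊑y , ⊑-refl y , λ _ _ y⊑w → y⊑w

  join-≥ : (x y : Bip n) → y ⊑ x → IsJoin x y x
  join-≥ x y y⊑x = ⊑-refl x , y⊑x , λ _ x⊑w _ → x⊑w

  meet-≤ : (x y : Bip n) → x ⊑ y → IsMeet x y x
  meet-≤ x y x⊑y = ⊑-refl x , x⊑y , λ _ w⊑x _ → w⊑x

  meet-≥ : (x y : Bip n) → y ⊑ x → IsMeet x y y
  meet-≥ x y y⊑x = y⊑x , ⊑-refl y , λ _ _ w⊑y → w⊑y

  Row Col : (Fin n → Bool) → Bip n
  Row K = mkBip (λ u _ → K u) (λ _ _ _ p _ → p) (λ _ _ _ p → inj₁ p)
  Col K = mkBip (λ _ v → K v) (λ _ _ _ _ q → q) (λ _ _ _ q → inj₂ q)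

  bot top : Bip n
  bot = Row (λ _ → false)
  top = Row (λ _ → true)

  bot⊑ : (x : Bip n) → bot ⊑ x
  bot⊑ x u v ()

  ⊑top : (x : Bip n) → x ⊑ top
  ⊑top x u v _ = tt

  -- x ∨ y = top, witnessed by every upper bound being full.
  Covers : Bip n → Bip n → Set
  Covers x y = ∀ w → x ⊑ w → y ⊑ w → ∀ u v → ⟦ w ⟧ u v

  Disjoint : Bip n → Bip n → Set
  Disjoint x y = ∀ u v → ⟦ x ⟧ u v → ⟦ y ⟧ u v → ⊥

  join-top : ∀ x y → Covers x y → IsJoin x y top
  join-top x y cov = ⊑top x , ⊑top y , λ w x⊑w y⊑w u v _ → cov w x⊑w y⊑w u v

  meet-bot : ∀ x y → Disjoint x y → IsMeet x y bot
  meet-bot x y dis = bot⊑ x , bot⊑ y , λ w w⊑x w⊑y u v h → ⊥-elim (dis u v (w⊑x u v h) (w⊑y u v h))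

  Rect : (Fin n → Bool) → Bip n
  Rect K = mkBip (λ u v → K u ∧ not (K v)) tr sp
    where
    tr : ∀ u v w → T (K u ∧ not (K v)) → T (K v ∧ not (K w)) → T (K u ∧ not (K w))
    tr u v w p q = ⊥-elim (not-T (∧-snd {K u} p) (∧-fst q))
    sp : ∀ u v w → T (K u ∧ not (K w)) → T (K u ∧ not (K v)) ⊎ T (K v ∧ not (K w))
    sp u v w h with T? (K v)
    ... | yes Kv = inj₂ (∧-intro Kv (∧-snd {K u} h))
    ... | no ¬Kv = inj₁ (∧-intro (∧-fst h) (T-not ¬Kv))

  Ranked : (Fin n → ℕ) → Bip n
  Ranked L = mkBip (λ u v → L u <ᵇ L v) tr sp
    where
    tr : ∀ u v w → T (L u <ᵇ L v) → T (L v <ᵇ L w) → T (L u <ᵇ L w)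
    tr u v w p q = <⇒<ᵇ (<-trans (<ᵇ⇒< (L u) (L v) p) (<ᵇ⇒< (L v) (L w) q))
    sp : ∀ u v w → T (L u <ᵇ L w) → T (L u <ᵇ L v) ⊎ T (L v <ᵇ L w)
    sp u v w h with T? (L u <ᵇ L v)
    ... | yes p = inj₁ p
    ... | no ¬p = inj₂ (<⇒<ᵇ (≤-<-trans (≮⇒≥ (¬p ∘ <⇒<ᵇ)) (<ᵇ⇒< (L u) (L w) h)))

  Ranked-irrefl : ∀ L u → ¬ ⟦ Ranked L ⟧ u u
  Ranked-irrefl L u h = <-irrefl refl (<ᵇ⇒< (L u) (L u) h)

  -- Complementation is an order-reversing involution of Bip(n); it is used
  -- to reduce statements about meets to statements about joins.
  compl : Bip n → Bip n
  compl x = mkBip (λ u v → not (rel x u v)) (proj₂ (proj₂ x)) sp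
    where
    sp : ∀ u v w → T (not (rel x u w)) → T (not (rel x u v)) ⊎ T (not (rel x v w))
    sp u v w h with T? (rel x u v) | T? (rel x v w)
    ... | no ¬p | _ = inj₁ (T-not ¬p)
    ... | yes _ | no ¬q = inj₂ (T-not ¬q)
    ... | yes p | yes q = ⊥-elim (not-T h (bip-trans x u v w p q))

  compl-antitone : ∀ x y → x ⊑ y → compl y ⊑ compl x
  compl-antitone x y x⊑y u v h = T-not (λ p → not-T h (x⊑y u v p))

  compl-swap : ∀ x y → compl x ⊑ y → compl y ⊑ x
  compl-swap x y cx⊑y u v h with T? (rel x u v)
  ... | yes p = p
  ... | no ¬p = ⊥-elim (not-T h (cx⊑y u v (T-not ¬p)))

  meet⇒join : ∀ {x y z} → IsMeet x y z → IsJoin (compl x) (compl y) (compl z)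
  meet⇒join {x} {y} {z} (z⊑x , z⊑y , glb) =
    compl-antitone z x z⊑x , compl-antitone z y z⊑y ,
    λ w cx⊑w cy⊑w → compl-swap w z (glb (compl w) (compl-swap x w cx⊑w) (compl-swap y w cy⊑w))

module _ {n : ℕ} where

  Pivot : Bip n → Fin n → Set
  Pivot x i = ∀ j → j ≢ i → ⟦ x ⟧ i j ⊎ ⟦ x ⟧ j i

  Acyclic : Bip n → Fin n → Set
  Acyclic x i = ∀ j → j ≢ i → ⟦ x ⟧ i j → ⟦ x ⟧ j i → ⊥

  loop⇒pivot : (x : Bip n) → ∀ {i} → ⟦ x ⟧ i i → Pivot x i
  loop⇒pivot x {i} h j _ = bip-split x i j i h

  ¬loop⇒acyclic : (x : Bip n) → ∀ {i} → ¬ ⟦ x ⟧ i i → Acyclic x i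
  ¬loop⇒acyclic x {i} ¬h j _ p q = ¬h (bip-trans x i j i p q)

  pivot-⊑ : ∀ {x y i} → x ⊑ y → Pivot x i → Pivot y i
  pivot-⊑ {i = i} x⊑y piv j ne with piv j ne
  ... | inj₁ p = inj₁ (x⊑y i j p)
  ... | inj₂ q = inj₂ (x⊑y j i q)

  SameOff : Bip n → Bip n → Set
  SameOff x y = ∀ u v → u ≢ v → rel x u v ≡ rel y u v

  sameOff-sym : ∀ {x y} → SameOff x y → SameOff y x
  sameOff-sym s u v ne = sym (s u v ne)

  sameOff⇒ : ∀ {x y} → SameOff x y → ∀ u v → u ≢ v → ⟦ x ⟧ u v → ⟦ y ⟧ u v
  sameOff⇒ s u v ne = subst T (s u v ne)

  pivot-sameOff : ∀ {x y i} → SameOff x y → Pivot x i → Pivot y i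
  pivot-sameOff {x} {y} {i} s piv j ne with piv j ne
  ... | inj₁ p = inj₁ (sameOff⇒ {x} {y} s i j (ne ∘ sym) p)
  ... | inj₂ q = inj₂ (sameOff⇒ {x} {y} s j i ne q)

  acyclic-sameOff : ∀ {x y i} → SameOff x y → Acyclic x i → Acyclic y i
  acyclic-sameOff {x} {y} {i} s acy j ne p q =
    acy j ne (sameOff⇒ {y} {x} (sameOff-sym {x} {y} s) i j (ne ∘ sym) p)
             (sameOff⇒ {y} {x} (sameOff-sym {x} {y} s) j i ne q)

  pivot-back : ∀ x {i j} → Pivot x i → j ≢ i → ¬ ⟦ x ⟧ i j → ⟦ x ⟧ j i
  pivot-back x {i} {j} piv ne ¬xij = [ ⊥-elim ∘ ¬xij , (λ xji → xji) ] (piv j ne)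

  sameOff-sameDiag : ∀ {x y} → SameOff x y → (∀ i → rel x i i ≡ rel y i i) → ∀ u v → rel x u v ≡ rel y u v
  sameOff-sameDiag s d u v with u ≟ v
  ... | yes refl = d u
  ... | no ne = s u v ne

  loop-row : ∀ {x z i} → x ⊑ z → ⟦ x ⟧ i i → Acyclic z i → ∀ j → j ≢ i → rel x i j ≡ rel z i j
  loop-row {x} {z} {i} x⊑z xi acy j ne = T-ext (x⊑z i j) back
    where
    back : ⟦ z ⟧ i j → ⟦ x ⟧ i j
    back zij with bip-split x i j i xi
    ... | inj₁ xij = xij
    ... | inj₂ xji = ⊥-elim (acy j ne zij (x⊑z j i xji))

  diagReplace : Bip n → (Fin n → Bool) → BRel n
  diagReplace x d u v = if u == v then d u else rel x u v

  diagReplace-diag : ∀ x d u → diagReplace x d u u ≡ d u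
  diagReplace-diag x d u rewrite ==-true {i = u} refl = refl

  diagReplace-off : ∀ x d {u v} → u ≢ v → diagReplace x d u v ≡ rel x u v
  diagReplace-off x d ne rewrite ==-false ne = refl

  withDiag : (x : Bip n) (d : Fin n → Bool) →
             (∀ i → T (d i) → Pivot x i) → (∀ i → ¬ T (d i) → Acyclic x i) → Bip n
  withDiag x d piv acy = mkBip r tr sp
    where
    r : BRel n
    r = diagReplace x d
    into : ∀ {u v} → u ≢ v → ⟦ x ⟧ u v → T (r u v)
    into ne = subst T (sym (diagReplace-off x d ne))
    out : ∀ {u v} → u ≢ v → T (r u v) → ⟦ x ⟧ u v
    out ne = subst T (diagReplace-off x d ne)
    tr : ∀ u v w → T (r u v) → T (r v w) → T (r u w)
    tr u v w p q with ≡-or-≢ u v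
    ... | inj₁ refl = q
    ... | inj₂ u≢v with ≡-or-≢ v w
    ...   | inj₁ refl = p
    ...   | inj₂ v≢w with ≡-or-≢ u w
    ...     | inj₂ u≢w = into u≢w (bip-trans x u v w (out u≢v p) (out v≢w q))
    ...     | inj₁ refl with T? (d u)
    ...       | yes du = subst T (sym (diagReplace-diag x d u)) du
    ...       | no ¬du = ⊥-elim (acy u ¬du v (u≢v ∘ sym) (out u≢v p) (out v≢w q))
    sp : ∀ u v w → T (r u w) → T (r u v) ⊎ T (r v w)
    sp u v w h with ≡-or-≢ v u
    ... | inj₁ refl = inj₂ h
    ... | inj₂ v≢u with ≡-or-≢ v w
    ...   | inj₁ refl = inj₁ h
    ...   | inj₂ v≢w with ≡-or-≢ u w
    ...     | inj₁ refl = [ inj₁ ∘ into (v≢u ∘ sym) , inj₂ ∘ into v≢u ]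
                            (piv u (subst T (diagReplace-diag x d u) h) v v≢u)
    ...     | inj₂ u≢w = [ inj₁ ∘ into (v≢u ∘ sym) , inj₂ ∘ into v≢w ] (bip-split x u v w (out u≢w h))

module Congruence {n : ℕ} (θ : Bip n → Bip n → Bool) (C : IsCongruence θ) where

  infix 4 _∼_
  _∼_ : Bip n → Bip n → Set
  x ∼ y = T (θ x y)

  ∼-refl : ∀ x → x ∼ x
  ∼-refl = proj₁ C

  ∼-sym : ∀ {x y} → x ∼ y → y ∼ x
  ∼-sym = proj₁ (proj₂ C) _ _

  ∼-trans : ∀ {x y z} → x ∼ y → y ∼ z → x ∼ z
  ∼-trans = proj₁ (proj₂ (proj₂ C)) _ _ _

  ∼-join : ∀ {x x′ y y′ z z′} → x ∼ x′ → y ∼ y′ → IsJoin x y z → IsJoin x′ y′ z′ → z ∼ z′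
  ∼-join = proj₁ (proj₂ (proj₂ (proj₂ C))) _ _ _ _ _ _

  ∼-meet : ∀ {x x′ y y′ z z′} → x ∼ x′ → y ∼ y′ → IsMeet x y z → IsMeet x′ y′ z′ → z ∼ z′
  ∼-meet = proj₂ (proj₂ (proj₂ (proj₂ C))) _ _ _ _ _ _

  ∼-pointwise : ∀ {x y} → (∀ u v → rel x u v ≡ rel y u v) → x ∼ y
  ∼-pointwise {x} {y} e =
    ∼-join (∼-refl x) (∼-refl x) (join-≤ x x (⊑-refl x)) (x⊑y , x⊑y , λ w x⊑w _ u v h → x⊑w u v (y⊑x u v h))
    where
    x⊑y : x ⊑ y
    x⊑y u v = subst T (e u v)
    y⊑x : y ⊑ x
    y⊑x u v = subst T (sym (e u v))

  ∼-total : bot ∼ top → ∀ x y → x ∼ y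
  ∼-total h x y = ∼-trans (up x) (∼-sym (up y))
    where
    up : ∀ x → x ∼ top
    up x = ∼-join h (∼-refl x) (join-≤ bot x (bot⊑ x)) (join-≥ top x (⊑top x))

  lift-to-top : ∀ {x y} z → x ∼ y → x ⊑ z → Covers y z → z ∼ top
  lift-to-top {x} {y} z h x⊑z cov = ∼-join h (∼-refl z) (join-≤ x z x⊑z) (join-top y z cov)

  drop-to-bot : ∀ {z} t → z ∼ top → Disjoint z t → bot ∼ t
  drop-to-bot {z} t h dis = ∼-meet h (∼-refl t) (meet-bot z t dis) (meet-≥ top t (⊑top t))

  transfer : ∀ {x} y z → bot ∼ x → Covers x y → Disjoint y z → bot ∼ z
  transfer y z h cov dis = drop-to-bot z (lift-to-top y h (bot⊑ y) cov) dis

  down-closed : ∀ {x} y → bot ∼ x → y ⊑ x → bot ∼ y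
  down-closed {x} y h y⊑x = ∼-meet h (∼-refl y) (meet-≤ bot y (bot⊑ y)) (meet-≥ x y y⊑x)

  join-collapse : ∀ {x y} → bot ∼ x → bot ∼ y → Covers x y → bot ∼ top
  join-collapse {x} {y} hx hy cov = ∼-join hx hy (join-≤ bot bot (⊑-refl bot)) (join-top x y cov)

full : ∀ {n} → Con n
full = (λ _ _ → true) , (λ _ → tt) , (λ _ _ _ → tt) , (λ _ _ _ _ _ → tt) ,
       (λ _ _ _ _ _ _ _ _ _ _ → tt) , (λ _ _ _ _ _ _ _ _ _ _ → tt)

module _ {n : ℕ} where

  ⁅_⁆ : Fin n → Fin n → Bool
  ⁅ a ⁆ u = u == a

  ∁ : (Fin n → Bool) → Fin n → Bool
  ∁ K u = not (K u)

-- Off the diagonal Bip(n) is simple as soon as n ≥ 3, i.e. any two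
-- points p , q have a third point c avoiding them.
module Simplicity {n : ℕ} (third : (p q : Fin n) → Σ (Fin n) λ c → c ≢ p × c ≢ q)
                  (θ : Bip n → Bip n → Bool) (C : IsCongruence θ) where
  open Congruence θ C

  -- If θ relates x and y although (p , q) ∈ y ∖ x, then θ collapses a
  -- rectangle K × ∁K with p ∈ K and q ∉ K (K = {p} ∪ {u | (p , u) ∈ x}).
  rectangle : ∀ {x y p q} → p ≢ q → ⟦ y ⟧ p q → ¬ ⟦ x ⟧ p q → x ∼ y →
              ∃ λ K → bot ∼ Rect K × T (K p) × ¬ T (K q)
  rectangle {x} {y} {p} {q} p≢q ypq ¬xpq h =
    K , drop-to-bot (Rect K) (lift-to-top Z h x⊑Z cover) disjoint , Kp , ¬Kq
    where
    K : Fin n → Bool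
    K u = (u == p) ∨ rel x p u
    Kp : T (K p)
    Kp = ∨-inl {p == p} (==-refl p)
    ¬Kq : ¬ T (K q)
    ¬Kq k with ∨-cases {q == p} k
    ... | inj₁ e = p≢q (sym (toWitness e))
    ... | inj₂ xpq = ¬xpq xpq
    closed : ∀ u v → ⟦ x ⟧ u v → T (K u) → T (K v)
    closed u v xuv Ku with ∨-cases {u == p} Ku
    ... | inj₁ e = ∨-inr {v == p} (subst (λ t → ⟦ x ⟧ t v) (toWitness e) xuv)
    ... | inj₂ xpu = ∨-inr {v == p} (bip-trans x p u v xpu xuv)
    Z : Bip n
    Z = compl (Rect K)
    x⊑Z : x ⊑ Z
    x⊑Z u v xuv = T-not (λ r → not-T (∧-snd {K u} r) (closed u v xuv (∧-fst r)))
    -- y ∨ Z = top: every pair goes into K, then along (p , q), then out of K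
    cover : Covers y Z
    cover w y⊑w Z⊑w u v =
      bip-trans w u p v (Z⊑w u p (T-not (λ r → not-T (∧-snd {K u} r) Kp)))
        (bip-trans w p q v (y⊑w p q ypq) (Z⊑w q v (T-not (λ r → ¬Kq (∧-fst r)))))
    disjoint : Disjoint Z (Rect K)
    disjoint u v z r = not-T z r

  -- A collapsed rectangle K × ∁K with p ∈ K makes all pairs avoiding p as
  -- target collapse: via Row K (using q ∉ K) and Row ⁅ p ⁆.
  avoid-target : ∀ K {p q} → bot ∼ Rect K → T (K p) → ¬ T (K q) → bot ∼ Col (∁ ⁅ p ⁆)
  avoid-target K {p} {q} h Kp ¬Kq = transfer (Col ⁅ p ⁆) (Col (∁ ⁅ p ⁆)) leaving-p cover₂ disjoint₂
    where
    cover₁ : Covers (Rect K) (Row (∁ K))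
    cover₁ w r s u v with T? (K u)
    ... | yes Ku = bip-trans w u q v (r u q (∧-intro Ku (T-not ¬Kq))) (s q v (T-not ¬Kq))
    ... | no ¬Ku = s u v (T-not ¬Ku)
    disjoint₁ : Disjoint (Row (∁ K)) (Row K)
    disjoint₁ u v a b = not-T a b
    only-p : Row ⁅ p ⁆ ⊑ Row K
    only-p u v e = subst (T ∘ K) (sym (toWitness e)) Kp
    leaving-p : bot ∼ Row ⁅ p ⁆
    leaving-p = down-closed (Row ⁅ p ⁆) (transfer (Row (∁ K)) (Row K) h cover₁ disjoint₁) only-p
    cover₂ : Covers (Row ⁅ p ⁆) (Col ⁅ p ⁆)
    cover₂ w r s u v = bip-trans w u p v (s u p (==-refl p)) (r p v (==-refl p))
    disjoint₂ : Disjoint (Col ⁅ p ⁆) (Col (∁ ⁅ p ⁆))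
    disjoint₂ u v a b = not-T b a

  -- Dually, all pairs avoiding q as source collapse: via Col (∁ K) (using
  -- p ∈ K) and Col ⁅ q ⁆.
  avoid-source : ∀ K {p q} → bot ∼ Rect K → T (K p) → ¬ T (K q) → bot ∼ Row (∁ ⁅ q ⁆)
  avoid-source K {p} {q} h Kp ¬Kq = transfer (Row ⁅ q ⁆) (Row (∁ ⁅ q ⁆)) entering-q cover₂ disjoint₂
    where
    cover₁ : Covers (Rect K) (Col K)
    cover₁ w r s u v with T? (K v)
    ... | yes Kv = s u v Kv
    ... | no ¬Kv = bip-trans w u p v (s u p Kp) (r p v (∧-intro Kp (T-not ¬Kv)))
    disjoint₁ : Disjoint (Col K) (Col (∁ K))
    disjoint₁ u v a b = not-T b a
    only-q : Col ⁅ q ⁆ ⊑ Col (∁ K)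
    only-q u v e = T-not (λ Kv → ¬Kq (subst (T ∘ K) (toWitness e) Kv))
    entering-q : bot ∼ Col ⁅ q ⁆
    entering-q = down-closed (Col ⁅ q ⁆) (transfer (Col K) (Col (∁ K)) h cover₁ disjoint₁) only-q
    cover₂ : Covers (Col ⁅ q ⁆) (Row ⁅ q ⁆)
    cover₂ w r s u v = bip-trans w u q v (r u q (==-refl q)) (s q v (==-refl q))
    disjoint₂ : Disjoint (Row ⁅ q ⁆) (Row (∁ ⁅ q ⁆))
    disjoint₂ u v a b = not-T b a

  -- Every pair (u , v) factors as
  -- (u , c) (c , v) through a third point c, which avoids p as target and q
  -- as source.
  simple : ∀ {x y p q} → p ≢ q → ⟦ y ⟧ p q → ¬ ⟦ x ⟧ p q → x ∼ y → bot ∼ top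
  simple {p = p} {q} p≢q ypq ¬xpq h with rectangle p≢q ypq ¬xpq h
  ... | K , hK , Kp , ¬Kq = join-collapse (avoid-target K hK Kp ¬Kq) (avoid-source K hK Kp ¬Kq) cover
    where
    c : Fin n
    c = proj₁ (third p q)
    cover : Covers (Col (∁ ⁅ p ⁆)) (Row (∁ ⁅ q ⁆))
    cover w a b u v = bip-trans w u c v (a u c (T-not (proj₁ (proj₂ (third p q)) ∘ toWitness)))
                                        (b c v (T-not (proj₂ (proj₂ (third p q)) ∘ toWitness)))

-- A row predicate speaks about a point i and a row X.  It may depend only
-- on X off i: the entry X i is the diagonal entry it is meant to classify.
RowPred : ℕ → Set
RowPred n = Fin n → (Fin n → Bool) → Bool

RowExt : ∀ {n} → RowPred n → Set
RowExt {n} P = ∀ i (X X′ : Fin n → Bool) → (∀ j → j ≢ i → X j ≡ X′ j) → P i X ≡ P i X′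

module _ {n : ℕ} where

  Related : RowPred n → Bip n → Bip n → Set
  Related P x y = SameOff x y × (∀ i → rel x i i ≢ rel y i i → T (P i (rel x i)))

  ext-sameOff : ∀ {P : RowPred n} → RowExt P → ∀ {x y} → SameOff x y → ∀ i → P i (rel x i) ≡ P i (rel y i)
  ext-sameOff ext s i = ext i _ _ (λ j ne → s i j (ne ∘ sym))

  related-mono : ∀ {P Q : RowPred n} → (∀ i X → T (P i X) → T (Q i X)) → ∀ {x y} → Related P x y → Related Q x y
  related-mono P⇒Q (s , lic) = s , λ i ne → P⇒Q i _ (lic i ne)

  related? : (P : RowPred n) → ∀ x y → Dec (Related P x y)
  related? P x y = all? (λ u → all? (λ v → ¬? (u ≟ v) →-dec (rel x u v ≟ᵇ rel y u v)))
                   ×-dec all? (λ i → ¬? (rel x i i ≟ᵇ rel y i i) →-dec T? (P i (rel x i)))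

  θ[_] : RowPred n → Bip n → Bip n → Bool
  θ[ P ] x y = ⌊ related? P x y ⌋

  module _ {P : RowPred n} (ext : RowExt P) where

    related-refl : ∀ x → Related P x x
    related-refl x = (λ _ _ _ → refl) , λ i ne → ⊥-elim (ne refl)

    related-sym : ∀ {x y} → Related P x y → Related P y x
    related-sym {x} {y} (s , lic) =
      sameOff-sym {x = x} {y = y} s , λ i ne → subst T (ext-sameOff ext {x} {y} s i) (lic i (ne ∘ sym))

    related-trans : ∀ {x y z} → Related P x y → Related P y z → Related P x z
    related-trans {x} {y} {z} (s₁ , lic₁) (s₂ , lic₂) = (λ u v ne → trans (s₁ u v ne) (s₂ u v ne)) , lic
      where
      lic : ∀ i → rel x i i ≢ rel z i i → T (P i (rel x i))
      lic i ne with rel x i i ≟ᵇ rel y i i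
      ... | no ne₁ = lic₁ i ne₁
      ... | yes e = subst T (sym (ext-sameOff ext {x} {y} s₁ i)) (lic₂ i (λ e′ → ne (trans e e′)))

    -- Adding the loops of x and y to
    -- z′ gives an upper bound w of x and y, so z ⊑ w: off the diagonal z is
    -- below z′, and a loop of z missing in z′ comes from x or y, with the
    -- row of z, where P licenses it.
    module JoinHalf {x x′ y y′ z z′ : Bip n} (rx : Related P x x′) (ry : Related P y y′)
                    (jz : IsJoin x y z) (jz′ : IsJoin x′ y′ z′) where

      loops : Fin n → Bool
      loops i = rel z′ i i ∨ (rel x i i ∨ rel y i i)

      pivot : ∀ i → T (loops i) → Pivot z′ i
      pivot i h with ∨-cases {rel z′ i i} h
      ... | inj₁ z′i = loop⇒pivot z′ z′i
      ... | inj₂ h′ with ∨-cases {rel x i i} h′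
      ...   | inj₁ xi = pivot-⊑ {x = x′} {y = z′} (proj₁ jz′)
                          (pivot-sameOff {x = x} {y = x′} (proj₁ rx) (loop⇒pivot x xi))
      ...   | inj₂ yi = pivot-⊑ {x = y′} {y = z′} (proj₁ (proj₂ jz′))
                          (pivot-sameOff {x = y} {y = y′} (proj₁ ry) (loop⇒pivot y yi))

      acyclic : ∀ i → ¬ T (loops i) → Acyclic z′ i
      acyclic i ¬l = ¬loop⇒acyclic z′ (¬l ∘ ∨-inl)

      w : Bip n
      w = withDiag z′ loops pivot acyclic

      below-w : ∀ {a a′} → Related P a a′ → a′ ⊑ z′ → (∀ i → ⟦ a ⟧ i i → T (loops i)) → a ⊑ w
      below-w {a} {a′} (s , _) a′⊑z′ lp u v h with ≡-or-≢ u v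
      ... | inj₁ refl = subst T (sym (diagReplace-diag z′ loops u)) (lp u h)
      ... | inj₂ ne = subst T (sym (diagReplace-off z′ loops ne)) (a′⊑z′ u v (sameOff⇒ {x = a} {y = a′} s u v ne h))

      z⊑w : z ⊑ w
      z⊑w = proj₂ (proj₂ jz) w
              (below-w {x} {x′} rx (proj₁ jz′) (λ i xi → ∨-inr {rel z′ i i} (∨-inl {rel x i i} xi)))
              (below-w {y} {y′} ry (proj₁ (proj₂ jz′)) (λ i yi → ∨-inr {rel z′ i i} (∨-inr {rel x i i} yi)))

      off-⊑ : ∀ u v → u ≢ v → ⟦ z ⟧ u v → ⟦ z′ ⟧ u v
      off-⊑ u v ne h = subst T (diagReplace-off z′ loops ne) (z⊑w u v h)

      licensed : SameOff z z′ → ∀ {a a′ i} → Related P a a′ → a ⊑ z → a′ ⊑ z′ →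
                 ¬ ⟦ z′ ⟧ i i → ⟦ a ⟧ i i → T (P i (rel z i))
      licensed s {a} {a′} {i} (_ , lic) a⊑z a′⊑z′ ¬z′i ai =
        subst T (ext i _ _ (loop-row {x = a} {z = z} a⊑z ai acy)) (lic i (λ e → ¬z′i (a′⊑z′ i i (subst T e ai))))
        where
        acy : Acyclic z i
        acy = acyclic-sameOff {x = z′} {y = z} (sameOff-sym {x = z} {y = z′} s) (¬loop⇒acyclic z′ ¬z′i)

      loop-licensed : SameOff z z′ → ∀ i → ⟦ z ⟧ i i → ¬ ⟦ z′ ⟧ i i → T (P i (rel z i))
      loop-licensed s i zi ¬z′i with ∨-cases {rel z′ i i} (subst T (diagReplace-diag z′ loops i) (z⊑w i i zi))
      ... | inj₁ z′i = ⊥-elim (¬z′i z′i)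
      ... | inj₂ h with ∨-cases {rel x i i} h
      ...   | inj₁ xi = licensed s {x} {x′} rx (proj₁ jz) (proj₁ jz′) ¬z′i xi
      ...   | inj₂ yi = licensed s {y} {y′} ry (proj₁ (proj₂ jz)) (proj₁ (proj₂ jz′)) ¬z′i yi

    related-join : ∀ {x x′ y y′ z z′} → Related P x x′ → Related P y y′ →
                   IsJoin x y z → IsJoin x′ y′ z′ → Related P z z′
    related-join {x} {x′} {y} {y′} {z} {z′} rx ry jz jz′ = s , lic
      where
      module H = JoinHalf {x} {x′} {y} {y′} {z} {z′} rx ry jz jz′
      module H′ = JoinHalf {x′} {x} {y′} {y} {z′} {z} (related-sym {x} {x′} rx) (related-sym {y} {y′} ry) jz′ jz
      s : SameOff z z′
      s u v ne = T-ext (H.off-⊑ u v ne) (H′.off-⊑ u v ne)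
      s′ : SameOff z′ z
      s′ = sameOff-sym {x = z} {y = z′} s
      lic : ∀ i → rel z i i ≢ rel z′ i i → T (P i (rel z i))
      lic i ne with differ ne
      ... | inj₁ (zi , ¬z′i) = H.loop-licensed s i zi ¬z′i
      ... | inj₂ (¬zi , z′i) = subst T (ext-sameOff ext {z′} {z} s′ i) (H′.loop-licensed s′ i z′i ¬zi)

  -- Complementation negates rows, so it transports Related P to Related of
  -- the dual predicate; this reduces meets to joins.
  dual : RowPred n → RowPred n
  dual P i X = P i (not ∘ X)

  dual-ext : ∀ {P} → RowExt P → RowExt (dual P)
  dual-ext ext i X X′ ag = ext i _ _ (λ j ne → cong not (ag j ne))

  related-compl : ∀ {P} → RowExt P → ∀ {x y} → Related P x y → Related (dual P) (compl x) (compl y)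
  related-compl ext {x} {y} (s , lic) =
    (λ u v ne → cong not (s u v ne)) ,
    λ i ne → subst T (ext i _ _ (λ j _ → sym (not-involutive (rel x i j)))) (lic i (ne ∘ cong not))

  related-uncompl : ∀ {P} → RowExt P → ∀ {x y} → Related (dual P) (compl x) (compl y) → Related P x y
  related-uncompl ext {x} {y} (s , lic) =
    (λ u v ne → not-injective (s u v ne)) ,
    λ i ne → subst T (ext i _ _ (λ j _ → not-involutive (rel x i j))) (lic i (ne ∘ not-injective))

  related-meet : ∀ {P} → RowExt P → ∀ {x x′ y y′ z z′} → Related P x x′ → Related P y y′ →
                 IsMeet x y z → IsMeet x′ y′ z′ → Related P z z′
  related-meet {P} ext {x} {x′} {y} {y′} {z} {z′} rx ry mz mz′ =
    related-uncompl ext {z} {z′}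
      (related-join {dual P} (dual-ext ext) {compl x} {compl x′} {compl y} {compl y′} {compl z} {compl z′}
                    (related-compl ext {x} {x′} rx) (related-compl ext {y} {y′} ry)
                    (meet⇒join {x = x} {y = y} {z = z} mz) (meet⇒join {x = x′} {y = y′} {z = z′} mz′))

  θ[]-congruence : ∀ {P} → RowExt P → IsCongruence θ[ P ]
  θ[]-congruence {P} ext =
    (λ x → fromWitness (related-refl ext x)) ,
    (λ x y h → fromWitness (related-sym ext {x} {y} (toWitness h))) ,
    (λ x y z h k → fromWitness (related-trans ext {x} {y} {z} (toWitness h) (toWitness k))) ,
    (λ x x′ y y′ z z′ h k j j′ →
       fromWitness (related-join ext {x} {x′} {y} {y′} {z} {z′} (toWitness h) (toWitness k) j j′)) ,
    (λ x x′ y y′ z z′ h k m m′ →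
       fromWitness (related-meet ext {x} {x′} {y} {y′} {z} {z′} (toWitness h) (toWitness k) m m′))

-- Levels of the ranking behind E i X: i sits at level 1, the points of X
-- above it and the remaining points below.
level : Bool → Bool → ℕ
level true _ = 1
level false true = 2
level false false = 0

level-< : ∀ a b c d → T (level a b <ᵇ level c d) →
          (T a × ¬ T c × T d) ⊎ (¬ T a × T c × ¬ T b) ⊎ (¬ T a × ¬ T c × ¬ T b × T d)
level-< true _ true _ ()
level-< true _ false true _ = inj₁ (tt , (λ ()) , tt)
level-< true _ false false ()
level-< false true true _ ()
level-< false true false true ()
level-< false true false false ()
level-< false false true _ _ = inj₂ (inj₁ ((λ ()) , tt , (λ ())))
level-< false false false true _ = inj₂ (inj₂ ((λ ()) , (λ ()) , (λ ()) , tt))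
level-< false false false false ()

module _ {n : ℕ} where

  -- E i X: the least bipartition with row X at i (off i) in which i is a
  -- pivot; it does not contain (i , i).
  E : Fin n → (Fin n → Bool) → Bip n
  E i X = Ranked (λ u → level (u == i) (X u))

  E-irrefl : ∀ i X u → ¬ ⟦ E i X ⟧ u u
  E-irrefl i X = Ranked-irrefl (λ u → level (u == i) (X u))

  E-off : ∀ i X {u v} → ⟦ E i X ⟧ u v → u ≢ v
  E-off i X {u} h refl = E-irrefl i X u h

  E-row : ∀ i X j → j ≢ i → rel (E i X) i j ≡ X j
  E-row i X j ne rewrite ==-true {i = i} refl | ==-false ne with X j
  ... | true = refl
  ... | false = refl

  E-col : ∀ i X j → j ≢ i → ¬ T (X j) → ⟦ E i X ⟧ j i
  E-col i X j ne ¬Xj rewrite ==-true {i = i} refl | ==-false ne | false-of ¬Xj = tt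

  E-ext : ∀ i X X′ → (∀ j → j ≢ i → X j ≡ X′ j) → ∀ u v → rel (E i X) u v ≡ rel (E i X′) u v
  E-ext i X X′ ag u v = cong₂ _<ᵇ_ (same u) (same v)
    where
    same : ∀ u → level (u == i) (X u) ≡ level (u == i) (X′ u)
    same u with ≡-or-≢ u i
    ... | inj₁ refl rewrite ==-true {i = u} refl = refl
    ... | inj₂ ne = cong (level (u == i)) (ag u ne)

  E-pivot : ∀ i X → Pivot (E i X) i
  E-pivot i X j ne with T? (X j)
  ... | yes Xj = inj₁ (subst T (sym (E-row i X j ne)) Xj)
  ... | no ¬Xj = inj₂ (E-col i X j ne ¬Xj)

  E-least : ∀ a i → Pivot a i → E i (rel a i) ⊑ a
  E-least a i piv u v h with level-< (u == i) (rel a i u) (v == i) (rel a i v) h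
  ... | inj₁ (u=i , _ , aiv) = subst (λ t → ⟦ a ⟧ t v) (sym (toWitness u=i)) aiv
  ... | inj₂ (inj₁ (u≠i , v=i , ¬aiu)) =
    subst (⟦ a ⟧ u) (sym (toWitness v=i)) (pivot-back a piv (u≠i ∘ fromWitness) ¬aiu)
  ... | inj₂ (inj₂ (u≠i , _ , ¬aiu , aiv)) = bip-trans a u i v (pivot-back a piv (u≠i ∘ fromWitness) ¬aiu) aiv

  E-pivot-at : ∀ i X u → T (u == i) → Pivot (E i X) u
  E-pivot-at i X u e = subst (Pivot (E i X)) (sym (toWitness e)) (E-pivot i X)

  E⁺ : Fin n → (Fin n → Bool) → Bip n
  E⁺ i X = withDiag (E i X) ⁅ i ⁆ (E-pivot-at i X) (λ u _ → ¬loop⇒acyclic (E i X) (E-irrefl i X u))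

  E⁺-loop : ∀ i X → ⟦ E⁺ i X ⟧ i i
  E⁺-loop i X = subst T (sym (diagReplace-diag (E i X) ⁅ i ⁆ i)) (==-refl i)

  E⁺-sameOff : ∀ i X → SameOff (E i X) (E⁺ i X)
  E⁺-sameOff i X u v ne = sym (diagReplace-off (E i X) ⁅ i ⁆ ne)

  E⁺-noLoop : ∀ i X j → j ≢ i → ¬ ⟦ E⁺ i X ⟧ j j
  E⁺-noLoop i X j ne h = ne (toWitness (subst T (diagReplace-diag (E i X) ⁅ i ⁆ j) h))

  E⊑E⁺ : ∀ i X → E i X ⊑ E⁺ i X
  E⊑E⁺ i X u v h = subst T (E⁺-sameOff i X u v (E-off i X h)) h

  E⁺-cases : ∀ i X u v → ⟦ E⁺ i X ⟧ u v → ⟦ E i X ⟧ u v ⊎ (u ≡ i × v ≡ i)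
  E⁺-cases i X u v h with ≡-or-≢ u v
  ... | inj₁ refl = inj₂ (u≡i , u≡i)
    where
    u≡i : u ≡ i
    u≡i = toWitness (subst T (diagReplace-diag (E i X) ⁅ i ⁆ u) h)
  ... | inj₂ ne = inj₁ (subst T (sym (E⁺-sameOff i X u v ne)) h)

  θ[]-toggle : ∀ {P : RowPred n} → RowExt P → ∀ i X → θ[ P ] (E i X) (E⁺ i X) ≡ P i X
  θ[]-toggle {P} ext i X = T-ext forth back
    where
    row-E : P i (rel (E i X) i) ≡ P i X
    row-E = ext i _ _ (E-row i X)
    forth : T (θ[ P ] (E i X) (E⁺ i X)) → T (P i X)
    forth h = subst T row-E (proj₂ (toWitness h) i (λ e → E-irrefl i X i (subst T (sym e) (E⁺-loop i X))))
    back : T (P i X) → T (θ[ P ] (E i X) (E⁺ i X))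
    back p = fromWitness (E⁺-sameOff i X , lic)
      where
      lic : ∀ j → rel (E i X) j j ≢ rel (E⁺ i X) j j → T (P j (rel (E i X) j))
      lic j ne with ≡-or-≢ j i
      ... | inj₁ refl = subst T (sym row-E) p
      ... | inj₂ j≢i = ⊥-elim (ne (trans (false-of (E-irrefl i X j)) (sym (false-of (E⁺-noLoop i X j j≢i)))))

<ᵇ-true : ∀ {m k} → m < k → (m <ᵇ k) ≡ true
<ᵇ-true p = Equivalence.to T-≡ (<⇒<ᵇ p)

<ᵇ-false : ∀ {m k} → ¬ m < k → (m <ᵇ k) ≡ false
<ᵇ-false {m} {k} ¬p = false-of (¬p ∘ <ᵇ⇒< m k)

<ᵇ-step : ∀ {m k} → m ≢ k → (m <ᵇ k) ≡ (m <ᵇ suc k)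
<ᵇ-step {m} {k} ne = T-ext (λ h → <⇒<ᵇ (m<n⇒m<1+n (<ᵇ⇒< m k h)))
                           (λ h → <⇒<ᵇ (≤∧≢⇒< (m<1+n⇒m≤n (<ᵇ⇒< m (suc k) h)) ne))

module _ {n : ℕ} where

  diagFrom : (x y : Bip n) → Fin n → Bool → Bool
  diagFrom x y j b = if b then rel y j j else rel x j j

  between : (x y : Bip n) → SameOff x y → (Fin n → Bool) → Bip n
  between x y s c = withDiag x (λ j → diagFrom x y j (c j)) piv acy
    where
    piv : ∀ j → T (diagFrom x y j (c j)) → Pivot x j
    piv j h with c j
    ... | true = pivot-sameOff {x = y} {y = x} (sameOff-sym {x = x} {y = y} s) (loop⇒pivot y h)
    ... | false = loop⇒pivot x h
    acy : ∀ j → ¬ T (diagFrom x y j (c j)) → Acyclic x j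
    acy j ¬h with c j
    ... | true = acyclic-sameOff {x = y} {y = x} (sameOff-sym {x = x} {y = y} s) (¬loop⇒acyclic y ¬h)
    ... | false = ¬loop⇒acyclic x ¬h

  module Interpolation {x y : Bip n} (s : SameOff x y) where

    mix : ℕ → Bip n
    mix k = between x y s (λ j → toℕ j <ᵇ k)

    mix-off : ∀ k → SameOff (mix k) x
    mix-off k u v = diagReplace-off x (λ j → diagFrom x y j (toℕ j <ᵇ k))

    mix-diag : ∀ k i → rel (mix k) i i ≡ diagFrom x y i (toℕ i <ᵇ k)
    mix-diag k = diagReplace-diag x (λ j → diagFrom x y j (toℕ j <ᵇ k))

    mix-start : ∀ u v → rel x u v ≡ rel (mix 0) u v
    mix-start = sameOff-sameDiag {x = x} {y = mix 0} (sameOff-sym {x = mix 0} {y = x} (mix-off 0))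
                  (λ i → sym (trans (mix-diag 0 i) (cong (diagFrom x y i) (<ᵇ-false {toℕ i} {0} λ ()))))

    mix-end : ∀ u v → rel (mix n) u v ≡ rel y u v
    mix-end = sameOff-sameDiag {x = mix n} {y = y} (λ u v ne → trans (mix-off n u v ne) (s u v ne))
                (λ i → trans (mix-diag n i) (cong (diagFrom x y i) (<ᵇ-true (toℕ<n i))))

    module Step (k : ℕ) (k<n : k < n) where

      j : Fin n
      j = fromℕ< k<n

      index-j : toℕ j ≡ k
      index-j = toℕ-fromℕ< k<n

      step-off : SameOff (mix k) (mix (suc k))
      step-off u v ne = trans (mix-off k u v ne) (sym (mix-off (suc k) u v ne))

      step-diag : ∀ i → i ≢ j → rel (mix k) i i ≡ rel (mix (suc k)) i i
      step-diag i ne = begin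
        rel (mix k) i i                   ≡⟨ mix-diag k i ⟩
        diagFrom x y i (toℕ i <ᵇ k)       ≡⟨ cong (diagFrom x y i) (<ᵇ-step index-≢) ⟩
        diagFrom x y i (toℕ i <ᵇ suc k)   ≡⟨ sym (mix-diag (suc k) i) ⟩
        rel (mix (suc k)) i i             ∎
        where
        open ≡-Reasoning
        index-≢ : toℕ i ≢ k
        index-≢ e = ne (toℕ-injective (trans e (sym index-j)))

      before-j : rel (mix k) j j ≡ rel x j j
      before-j = trans (mix-diag k j) (cong (diagFrom x y j) (<ᵇ-false (<-irrefl index-j)))

      after-j : rel (mix (suc k)) j j ≡ rel y j j
      after-j = trans (mix-diag (suc k) j) (cong (diagFrom x y j) (<ᵇ-true (subst (_< suc k) (sym index-j) (n<1+n k))))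

module Toggles {n : ℕ} (θ : Bip n → Bip n → Bool) (C : IsCongruence θ) where
  open Congruence θ C

  Pθ : RowPred n
  Pθ i X = θ (E i X) (E⁺ i X)

  Pθ-ext : RowExt Pθ
  Pθ-ext i X X′ ag = T-ext (move X X′ ag) (move X′ X (λ j ne → sym (ag j ne)))
    where
    move : ∀ X X′ → (∀ j → j ≢ i → X j ≡ X′ j) → E i X ∼ E⁺ i X → E i X′ ∼ E⁺ i X′
    move X X′ ag h = ∼-trans (∼-sym (∼-pointwise {E i X} {E i X′} (E-ext i X X′ ag)))
                             (∼-trans h (∼-pointwise {E⁺ i X} {E⁺ i X′} same⁺))
      where
      same⁺ : ∀ u v → rel (E⁺ i X) u v ≡ rel (E⁺ i X′) u v
      same⁺ u v = cong (if u == v then u == i else_) (E-ext i X X′ ag u v)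

  -- If θ relates x and y, which agree off the diagonal and (i , i) ∈ y ∖ x,
  -- then θ collapses the toggle at i with the row of x: meeting with
  -- E⁺ i X gives E i X from x and E⁺ i X from y.
  detect : ∀ {x y i} → x ∼ y → SameOff x y → ¬ ⟦ x ⟧ i i → ⟦ y ⟧ i i → T (Pθ i (rel x i))
  detect {x} {y} {i} h s ¬xi yi = ∼-meet h (∼-refl (E⁺ i X)) (E⊑x , E⊑E⁺ i X , glb) (meet-≥ y (E⁺ i X) E⁺⊑y)
    where
    X : Fin n → Bool
    X = rel x i
    E⊑x : E i X ⊑ x
    E⊑x = E-least x i (pivot-sameOff {x = y} {y = x} (sameOff-sym {x = x} {y = y} s) (loop⇒pivot y yi))
    glb : ∀ w → w ⊑ x → w ⊑ E⁺ i X → w ⊑ E i X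
    glb w w⊑x w⊑E⁺ u v h with E⁺-cases i X u v (w⊑E⁺ u v h)
    ... | inj₁ e = e
    ... | inj₂ (refl , refl) = ⊥-elim (¬xi (w⊑x i i h))
    E⁺⊑y : E⁺ i X ⊑ y
    E⁺⊑y u v h with E⁺-cases i X u v h
    ... | inj₁ e = sameOff⇒ {x = x} {y = y} s u v (E-off i X e) (E⊑x u v e)
    ... | inj₂ (refl , refl) = yi

  -- Conversely, if b is a together with the loop (i , i), then a ∼ b as
  -- soon as θ collapses the toggle at i with the row of a: joining with
  -- E i X gives a and joining with E⁺ i X gives b.
  raise : ∀ {a b i} → SameOff a b → (∀ j → j ≢ i → rel a j j ≡ rel b j j) → ¬ ⟦ a ⟧ i i → ⟦ b ⟧ i i →
          T (Pθ i (rel a i)) → a ∼ b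
  raise {a} {b} {i} s d ¬ai bi toggled = ∼-join (∼-refl a) toggled (join-≥ a (E i X) E⊑a) (a⊑b , E⁺⊑b , lub)
    where
    X : Fin n → Bool
    X = rel a i
    E⊑a : E i X ⊑ a
    E⊑a = E-least a i (pivot-sameOff {x = b} {y = a} (sameOff-sym {x = a} {y = b} s) (loop⇒pivot b bi))
    a⊑b : a ⊑ b
    a⊑b u v h with ≡-or-≢ u v
    ... | inj₂ ne = sameOff⇒ {x = a} {y = b} s u v ne h
    ... | inj₁ refl with ≡-or-≢ u i
    ...   | inj₁ refl = ⊥-elim (¬ai h)
    ...   | inj₂ ne = subst T (d u ne) h
    E⁺⊑b : E⁺ i X ⊑ b
    E⁺⊑b u v h with E⁺-cases i X u v h
    ... | inj₁ e = a⊑b u v (E⊑a u v e)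
    ... | inj₂ (refl , refl) = bi
    lub : ∀ w → a ⊑ w → E⁺ i X ⊑ w → b ⊑ w
    lub w a⊑w E⁺⊑w u v h with ≡-or-≢ u v
    ... | inj₂ ne = a⊑w u v (sameOff⇒ {x = b} {y = a} (sameOff-sym {x = a} {y = b} s) u v ne h)
    ... | inj₁ refl with ≡-or-≢ u i
    ...   | inj₁ refl = E⁺⊑w i i (E⁺-loop i X)
    ...   | inj₂ ne = a⊑w u u (subst T (sym (d u ne)) h)

  toggle : ∀ {a b i} → SameOff a b → (∀ j → j ≢ i → rel a j j ≡ rel b j j) →
           (rel a i i ≢ rel b i i → T (Pθ i (rel a i))) → a ∼ b
  toggle {a} {b} {i} s d lic with rel a i i ≟ᵇ rel b i i
  ... | yes e = ∼-pointwise {a} {b} (sameOff-sameDiag {x = a} {y = b} s diag)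
    where
    diag : ∀ j → rel a j j ≡ rel b j j
    diag j with ≡-or-≢ j i
    ... | inj₁ refl = e
    ... | inj₂ ne = d j ne
  ... | no ne with differ ne
  ...   | inj₂ (¬ai , bi) = raise {a} {b} s d ¬ai bi (lic ne)
  ...   | inj₁ (ai , ¬bi) = ∼-sym (raise {b} {a} (sameOff-sym {x = a} {y = b} s) (λ j ne′ → sym (d j ne′)) ¬bi ai
                                     (subst T (ext-sameOff Pθ-ext {a} {b} s i) (lic ne)))

  -- Every congruence contains θ[ Pθ ]: walk from x to y along the
  -- interpolation chain, one diagonal point at a time.
  complete : ∀ {x y} → Related Pθ x y → x ∼ y
  complete {x} {y} (s , lic) = ∼-trans (chain n ≤-refl) (∼-pointwise {mix n} {y} mix-end)
    where
    open Interpolation {x = x} {y = y} s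
    chain : ∀ k → k ≤ n → x ∼ mix k
    chain zero _ = ∼-pointwise {x} {mix 0} mix-start
    chain (suc k) k<n = ∼-trans (chain k (<⇒≤ k<n)) (toggle {mix k} {mix (suc k)} {j} step-off step-diag licensed)
      where
      open Step k k<n
      licensed : rel (mix k) j j ≢ rel (mix (suc k)) j j → T (Pθ j (rel (mix k) j))
      licensed ne = subst T (ext-sameOff Pθ-ext {x} {mix k} (sameOff-sym {x = mix k} {y = x} (mix-off k)) j)
                      (lic j (λ e → ne (trans before-j (trans e (sym after-j)))))

module Characterisation {n : ℕ} (third : (p q : Fin n) → Σ (Fin n) λ c → c ≢ p × c ≢ q)
                        (θ : Bip n → Bip n → Bool) (C : IsCongruence θ) where
  open Congruence θ C
  open Toggles θ C
  open Simplicity third θ C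

  off-stable : ¬ bot ∼ top → ∀ {x y} → x ∼ y → ∀ u v → u ≢ v → ⟦ x ⟧ u v → ⟦ y ⟧ u v
  off-stable nt {x} {y} h u v ne xuv with T? (rel y u v)
  ... | yes yuv = yuv
  ... | no ¬yuv = ⊥-elim (nt (simple ne xuv ¬yuv (∼-sym h)))

  sound : ¬ bot ∼ top → ∀ {x y} → x ∼ y → Related Pθ x y
  sound nt {x} {y} h = s , lic
    where
    s : SameOff x y
    s u v ne = T-ext (off-stable nt h u v ne) (off-stable nt (∼-sym h) u v ne)
    s′ : SameOff y x
    s′ = sameOff-sym {x = x} {y = y} s
    lic : ∀ i → rel x i i ≢ rel y i i → T (Pθ i (rel x i))
    lic i ne with differ ne
    ... | inj₂ (¬xi , yi) = detect h s ¬xi yi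
    ... | inj₁ (xi , ¬yi) = subst T (ext-sameOff Pθ-ext {y} {x} s′ i) (detect (∼-sym h) s′ ¬yi xi)

-- Boolean rows on m points are coded by Fin (2 ^ m), through Fin 2 ≅ Bool.
encodeRow : ∀ {m} → (Fin m → Bool) → Fin (2 ^ m)
encodeRow X = funToFin (Inverse.from 2↔Bool ∘ X)

decodeRow : ∀ {m} → Fin (2 ^ m) → Fin m → Bool
decodeRow c = Inverse.to 2↔Bool ∘ finToFun c

funToFin-cong : ∀ {m k} {f g : Fin m → Fin k} → f ≗ g → funToFin f ≡ funToFin g
funToFin-cong {zero} _ = refl
funToFin-cong {suc m} e = cong₂ combine (e zero) (funToFin-cong (e ∘ suc))

encodeRow-cong : ∀ {m} {X X′ : Fin m → Bool} → X ≗ X′ → encodeRow X ≡ encodeRow X′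
encodeRow-cong e = funToFin-cong (cong (Inverse.from 2↔Bool) ∘ e)

decode-encodeRow : ∀ {m} (X : Fin m → Bool) → decodeRow (encodeRow X) ≗ X
decode-encodeRow X j =
  trans (cong (Inverse.to 2↔Bool) (finToFun-funToFin (Inverse.from 2↔Bool ∘ X) j)) (Inverse.strictlyInverseˡ 2↔Bool (X j))

encode-decodeRow : ∀ {m} (c : Fin (2 ^ m)) → encodeRow {m} (decodeRow c) ≡ c
encode-decodeRow {m} c =
  trans (funToFin-cong {m} (λ j → Inverse.strictlyInverseʳ 2↔Bool (finToFun c j))) (funToFin-finToFin {m} {2} c)

-- A pair over suc m points is coded by the point and the code of the row
-- with the point itself punched out.
module PairCode (m : ℕ) where

  code : Fin (suc m) → (Fin (suc m) → Bool) → Fin (suc m * 2 ^ m)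
  code i X = combine i (encodeRow (X ∘ punchIn i))

  -- The row with entries c off i (its entry at i is irrelevant).
  rowAt : Fin (suc m) → Fin (2 ^ m) → Fin (suc m) → Bool
  rowAt i c j with i ≟ j
  ... | yes _ = false
  ... | no ne = decodeRow {m} c (punchOut ne)

  point : Fin (suc m * 2 ^ m) → Fin (suc m)
  point t = proj₁ (remQuot {suc m} (2 ^ m) t)

  row : Fin (suc m * 2 ^ m) → Fin (suc m) → Bool
  row t = rowAt (point t) (proj₂ (remQuot {suc m} (2 ^ m) t))

  code-cong : ∀ i X X′ → (∀ j → j ≢ i → X j ≡ X′ j) → code i X ≡ code i X′
  code-cong i X X′ ag = cong (combine i) (encodeRow-cong (λ j → ag (punchIn i j) (punchInᵢ≢i i j)))

  rowAt-punchIn : ∀ i c j → rowAt i c (punchIn i j) ≡ decodeRow {m} c j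
  rowAt-punchIn i c j with i ≟ punchIn i j
  ... | yes e = ⊥-elim (punchInᵢ≢i i j (sym e))
  ... | no ne = cong (decodeRow {m} c) (trans (punchOut-cong i refl) (punchOut-punchIn i))

  rowAt-encode : ∀ i X j → j ≢ i → rowAt i (encodeRow (X ∘ punchIn i)) j ≡ X j
  rowAt-encode i X j ne with i ≟ j
  ... | yes e = ⊥-elim (ne (sym e))
  ... | no i≢j = trans (decode-encodeRow (X ∘ punchIn i) (punchOut i≢j)) (cong X (punchIn-punchOut i≢j))

  code-decode : ∀ t → code (point t) (row t) ≡ t
  code-decode t = trans (cong (combine i) (trans (encodeRow-cong (rowAt-punchIn i c)) (encode-decodeRow {m} c)))
                        (combine-remQuot {suc m} (2 ^ m) t)
    where
    i : Fin (suc m)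
    i = point t
    c : Fin (2 ^ m)
    c = proj₂ (remQuot {suc m} (2 ^ m) t)

  decode-code : ∀ {P : RowPred (suc m)} → RowExt P → ∀ i X → P (point (code i X)) (row (code i X)) ≡ P i X
  decode-code {P} ext i X = via (cong proj₁ decoded) (λ j ne → trans (cong (λ ic → rowAt (proj₁ ic) (proj₂ ic) j) decoded)
                                                                     (rowAt-encode i X j ne))
    where
    decoded : remQuot {suc m} (2 ^ m) (code i X) ≡ (i , encodeRow (X ∘ punchIn i))
    decoded = remQuot-combine {suc m} {2 ^ m} i _
    via : ∀ {i′ X′} → i′ ≡ i → (∀ j → j ≢ i → X′ j ≡ X j) → P i′ X′ ≡ P i X
    via refl ag = ext _ _ _ ag

avoid-two : ∀ {m} (p q : Fin (3 + m)) → Σ (Fin (3 + m)) λ c → c ≢ p × c ≢ q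
avoid-two (suc p) (suc q) = zero , (λ ()) , (λ ())
avoid-two zero q with suc zero ≟ q
... | no ne = suc zero , (λ ()) , ne
... | yes refl = suc (suc zero) , (λ ()) , (λ ())
avoid-two (suc p) zero with suc zero ≟ suc p
... | no ne = suc zero , ne , (λ ())
... | yes refl = suc (suc zero) , (λ ()) , (λ ())

∈⇒T : ∀ {k} {S : Subset k} {t} → t ∈ S → T (lookup S t)
∈⇒T t∈S = subst T (sym ([]=⇒lookup t∈S)) tt

T⇒∈ : ∀ {k} {S : Subset k} {t} → T (lookup S t) → t ∈ S
T⇒∈ {S = S} {t} h = lookup⇒[]= t S (Equivalence.to T-≡ h)

-- Con(Bip (suc m)) ≅ Subset (suc m · 2 ^ m) plus a top: a non-total
-- congruence goes to the codes of the toggles it collapses, the total one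
-- to the top.
module Assembly (m : ℕ) (third : (p q : Fin (suc m)) → Σ (Fin (suc m)) λ c → c ≢ p × c ≢ q) where
  open PairCode m

  N K : ℕ
  N = suc m
  K = N * 2 ^ m

  toggles : (Bip N → Bip N → Bool) → Subset K
  toggles θ = tabulate (λ t → θ (E (point t) (row t)) (E⁺ (point t) (row t)))

  member : Subset K → RowPred N
  member S i X = lookup S (code i X)

  member-ext : ∀ S → RowExt (member S)
  member-ext S i X X′ ag = cong (lookup S) (code-cong i X X′ ag)

  member-toggles : ∀ θ C i X → member (toggles θ) i X ≡ Toggles.Pθ θ C i X
  member-toggles θ C i X =
    trans (lookup∘tabulate _ (code i X)) (decode-code {P = Toggles.Pθ θ C} (Toggles.Pθ-ext θ C) i X)

  module NonTotal (θ : Bip N → Bip N → Bool) (C : IsCongruence θ) (nt : ¬ T (θ bot top)) where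
    open Toggles θ C
    open Characterisation third θ C

    related⇒ : ∀ {x y} → Related (member (toggles θ)) x y → T (θ x y)
    related⇒ {x} {y} r = complete {x} {y} (related-mono (λ i X → subst T (member-toggles θ C i X)) {x} {y} r)

    ⇒related : ∀ {x y} → T (θ x y) → Related (member (toggles θ)) x y
    ⇒related {x} {y} h = related-mono {P = Pθ} (λ i X → subst T (sym (member-toggles θ C i X))) {x} {y} (sound nt h)

  to : Con N → WithTop (Subset K)
  to (θ , _) with θ bot top
  ... | true = ⊤ᵗ
  ... | false = ↑ toggles θ

  from : WithTop (Subset K) → Con N
  from ⊤ᵗ = full
  from (↑ S) = θ[ member S ] , θ[]-congruence (member-ext S)

  from-to : ∀ θ → from (to θ) ≈ᶜ θ
  from-to (θ , C) with θ bot top in e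
  ... | true = (λ x y _ → ∼-total (subst T (sym e) tt) x y) , (λ _ _ _ → tt)
    where open Congruence θ C
  ... | false = (λ x y h → related⇒ (toWitness h)) , (λ x y h → fromWitness (⇒related h))
    where open NonTotal θ C (subst T e)

  -- θ[ member S ] separates bot and top, which differ at (0 , c) for any
  -- point c ≢ 0, and collapses exactly the toggles coded in S.
  separates : ∀ S → θ[ member S ] bot top ≡ false
  separates S = false-of (λ h → false≢true (proj₁ (toWitness h) zero c (c≢0 ∘ sym)))
    where
    c : Fin N
    c = proj₁ (third zero zero)
    c≢0 : c ≢ zero
    c≢0 = proj₁ (proj₂ (third zero zero))
    false≢true : false ≢ true
    false≢true ()

  toggles-member : ∀ S → toggles θ[ member S ] ≡ S
  toggles-member S = trans (tabulate-cong at) (tabulate∘lookup S)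
    where
    at : ∀ t → θ[ member S ] (E (point t) (row t)) (E⁺ (point t) (row t)) ≡ lookup S t
    at t = trans (θ[]-toggle (member-ext S) (point t) (row t)) (cong (lookup S) (code-decode t))

  to-from : ∀ t → to (from t) ≡ t
  to-from ⊤ᵗ = refl
  to-from (↑ S) rewrite separates S = cong ↑_ (toggles-member S)

  order : ∀ θ ψ → (θ ≤ᶜ ψ) ⇔ (to θ ≤ᵗ to ψ)
  order (θ , C) (ψ , D) with θ bot top in e₁ | ψ bot top in e₂
  ... | _ | true = mk⇔ (λ _ → tt) (λ _ x y _ → Congruence.∼-total ψ D (subst T (sym e₂) tt) x y)
  ... | true | false = mk⇔ (λ h → subst T e₂ (h bot top (subst T (sym e₁) tt))) (λ ())
  ... | false | false = mk⇔ forth back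
    where
    module θ′ = NonTotal θ C (subst T e₁)
    module ψ′ = NonTotal ψ D (subst T e₂)
    forth : (θ , C) ≤ᶜ (ψ , D) → toggles θ ⊆ toggles ψ
    forth h {t} t∈ =
      T⇒∈ (subst T (sym (lookup∘tabulate _ t)) (h _ _ (subst T (lookup∘tabulate _ t) (∈⇒T t∈))))
    back : toggles θ ⊆ toggles ψ → (θ , C) ≤ᶜ (ψ , D)
    back sub x y h = ψ′.related⇒ {x} {y} (related-mono {P = member (toggles θ)} {Q = member (toggles ψ)}
                                           (λ i X p → ∈⇒T (sub (T⇒∈ p))) {x} {y} (θ′.⇒related h))

corollary8p6 : ∀ (n : ℕ) → 3 ≤ n → ConIsoBoolTop n (n * 2 ^ (n ∸ 1))
corollary8p6 zero ()
corollary8p6 (suc zero) (s≤s ())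
corollary8p6 (suc (suc zero)) (s≤s (s≤s ()))
corollary8p6 (suc (suc (suc m))) _ = to , from , from-to , to-from , order
  where open Assembly (suc (suc m)) avoid-two
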